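{- Let $G$ be a graph of girth at least $5$ and minimum degree $d$. Let $T$ be a forest on $d$ vertices with components $T_1,\ldots,T_t$, and for each $1\le i\le t$ let $u_i$ be a vertex of $T_i$. Let $S=\{v_1,\ldots,v_t\}$ be an independent set of $G$ of size $t$. Then there exists an injective graph homomorphism $f:V(T)\to V(G)$ such that $f(u_i)=v_i$ for all $1\le i\le t$, and $f(V(T))$ induces a copy of $T$ in $G$ (i.e. $f$ is an isomorphism from $T$ onto the induced subgraph $G[f(V(T))]$).
   Context: Graphs are finite and simple. The girth of a graph is the length of its shortest cycle. -}

module Defs where

open import Data.Nat using (ℕ; zero; suc; _≤_)
open import Data.Fin using (Fin; zero; suc; inject₁; fromℕ)
open import Data.Bool using (Bool; true; false)
open import Data.List using (length; filterᵇ; allFin)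
open import Data.Product using (Σ; ∃; ∃-syntax; _×_; _,_)
open import Relation.Binary.PropositionalEquality using (_≡_; _≢_)
open import Relation.Binary.Construct.Closure.ReflexiveTransitive using (Star)
open import Relation.Nullary using (¬_)
open import Function.Definitions using (Injective)
open import Function.Bundles using (_⇔_)

record Graph (n : ℕ) : Set where
  field
    adj   : Fin n → Fin n → Bool
    sym   : ∀ x y → adj x y ≡ adj y x
    irrefl : ∀ x → adj x x ≡ false

open Graph public

Adj : ∀ {n} → Graph n → Fin n → Fin n → Set
Adj G x y = adj G x y ≡ true

degree : ∀ {n} → Graph n → Fin n → ℕ
degree {n} G x = length (filterᵇ (adj G x) (allFin n))

MinDegree : ∀ {n} → Graph n → ℕ → Set
MinDegree {n} G d = (∀ x → d ≤ degree G x) × (∃[ x ] degree G x ≡ d)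

-- A cycle of length (suc m), m ≥ 2: distinct vertices c 0, …, c m with
-- c i ~ c (i+1) for i < m and c m ~ c 0.
record Cycle {n : ℕ} (G : Graph n) (m : ℕ) : Set where
  field
    len≥3  : 2 ≤ m
    vert   : Fin (suc m) → Fin n
    inj    : Injective _≡_ _≡_ vert
    step   : ∀ (i : Fin m) → Adj G (vert (inject₁ i)) (vert (suc i))
    close  : Adj G (vert (fromℕ m)) (vert zero)

GirthAtLeast : ∀ {n} → Graph n → ℕ → Set
GirthAtLeast G k = ∀ m → Cycle G m → k ≤ suc m

Forest : ∀ {n} → Graph n → Set
Forest G = ∀ m → ¬ Cycle G m

Connected : ∀ {n} → Graph n → Fin n → Fin n → Set
Connected G = Star (Adj G)

-- u : Fin t → Fin d picks one vertex u i from each component T_i: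
-- every vertex lies in the component of exactly one u i.
-- (Hence t is the number of components.)
ComponentReps : ∀ {d t} → Graph d → (Fin t → Fin d) → Set
ComponentReps {d} {t} T u =
  ∀ x → Σ (Fin t) λ i → Connected T x (u i) × (∀ j → Connected T x (u j) → j ≡ i)

IndependentSet : ∀ {n t} → Graph n → (Fin t → Fin n) → Set
IndependentSet G v = Injective _≡_ _≡_ v × (∀ i j → ¬ Adj G (v i) (v j))

module Submission where

-- We grow a partial embedding of T into G: a duplicate-free list P of
-- vertices of T containing every root u i, and a map f sending u i to v i
-- which is an isomorphism from T[P] onto G[f(P)]; moreover every vertex of
-- P is joined to a root by a walk inside P.  Initially P = {u i}; this works
-- because the v i are independent and the u i lie in distinct components.
-- While P misses a vertex, connectivity yields an edge x ~ y with x ∉ P and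
-- y ∈ P.  Since T is a forest, y is the only neighbour of x in P.  Since G
-- has girth ≥ 5, every q ∈ P other than y blocks at most one neighbour of
-- f y (the one equal or adjacent to f q); as |P| < d ≤ deg (f y), some
-- neighbour w of f y is unblocked, and f x := w extends the embedding.

open import Defs
open import Data.Nat as ℕ using (ℕ; zero; suc; _≤_; _<_; _+_; z≤n; s≤s)
import Data.Nat.Properties as ℕP
open import Data.Fin using (Fin; zero; suc; inject₁; fromℕ; _≟_)
import Data.Fin.Properties as FinP
open import Data.Bool using (true)
open import Data.Bool.Properties using (T-≡)
import Data.Bool as Bool
open import Data.List using (List; []; _∷_; length; lookup; map; filter; filterᵇ; allFin)
open import Data.List.Relation.Unary.All as All using (All; []; _∷_)
open import Data.List.Relation.Unary.All.Properties.Core using (¬Any⇒All¬)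
open import Data.List.Relation.Unary.Any using (here; there)
open import Data.List.Relation.Unary.AllPairs using ([]; _∷_)
open import Data.List.Relation.Unary.Unique.Propositional using (Unique)
import Data.List.Relation.Unary.Unique.Propositional.Properties as UniqueP
open import Data.List.Membership.Propositional using (_∈_; _∉_)
open import Data.List.Membership.Propositional.Properties
  using (∈-filter⁻; ∈-map⁺; ∈-map⁻; ∈-allFin; ∈-lookup)
import Data.List.Membership.DecPropositional as DecMembership
open import Data.List.Properties using (filter-accept; filter-reject; filter-all)
open import Data.Vec.Functional using (updateAt)
open import Data.Vec.Functional.Properties using (updateAt-updates; updateAt-minimal)
open import Data.Product using (Σ; _×_; _,_; proj₁; proj₂)
open import Data.Sum using (_⊎_; inj₁; inj₂)
open import Data.Unit using (⊤; tt)
open import Data.Empty using (⊥; ⊥-elim)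
open import Relation.Binary.PropositionalEquality
  using (_≡_; _≢_; refl; trans; cong; subst; subst₂; ≢-sym) renaming (sym to ≡-sym)
open import Relation.Nullary using (¬_; Dec; yes; no)
open import Relation.Nullary.Decidable using (_⊎-dec_; _×-dec_; ¬?; T?)
open import Relation.Unary using (Decidable)
open import Relation.Binary.Construct.Closure.ReflexiveTransitive using (Star; ε; _◅_)
open import Function.Definitions using (Injective)
open import Function.Bundles using (_⇔_; mk⇔; Equivalence)

lookup-injective : ∀ {A : Set} (xs : List A) → Unique xs → Injective _≡_ _≡_ (lookup xs)
lookup-injective (x ∷ xs) _         {zero}  {zero}  _  = refl
lookup-injective (x ∷ xs) (x∉ ∷ _)  {zero}  {suc j} eq = ⊥-elim (All.lookup x∉ (∈-lookup j) eq)
lookup-injective (x ∷ xs) (x∉ ∷ _)  {suc i} {zero}  eq = ⊥-elim (All.lookup x∉ (∈-lookup i) (≡-sym eq))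
lookup-injective (x ∷ xs) (_ ∷ uxs) {suc i} {suc j} eq = cong suc (lookup-injective xs uxs eq)

missing⇒length< : ∀ {d} {P : List (Fin d)} {z} → Unique P → z ∉ P → length P < d
missing⇒length< {P = P} uniqueP z∉ =
  FinP.injective⇒≤ (lookup-injective (_ ∷ P) (¬Any⇒All¬ P z∉ ∷ uniqueP))

lastOf : ∀ {A : Set} → A → List A → A
lastOf c []       = c
lastOf c (y ∷ ys) = lastOf y ys

lookup-last : ∀ {A : Set} (c : A) (ys : List A) → lookup (c ∷ ys) (fromℕ (length ys)) ≡ lastOf c ys
lookup-last c []       = refl
lookup-last c (y ∷ ys) = lookup-last y ys

module Survivor {A B : Set} (Blocks : B → A → Set) (blocks? : ∀ κ w → Dec (Blocks κ w)) where

  unblocked? : (κ : B) → Decidable (λ w → ¬ Blocks κ w)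
  unblocked? κ w = ¬? (blocks? κ w)

  AtMostOne : B → List A → Set
  AtMostOne κ ws = ∀ {w₁ w₂} → w₁ ∈ ws → w₂ ∈ ws → Blocks κ w₁ → Blocks κ w₂ → w₁ ≡ w₂

  length-unblocked : ∀ κ ws → Unique ws → AtMostOne κ ws →
                     length ws ≤ suc (length (filter (unblocked? κ) ws))
  length-unblocked κ []       _          _   = z≤n
  length-unblocked κ (w ∷ ws) (w∉ ∷ uws) one = by-cases (blocks? κ w)
    where
    by-cases : Dec (Blocks κ w) → length (w ∷ ws) ≤ suc (length (filter (unblocked? κ) (w ∷ ws)))
    by-cases (yes κw) rewrite filter-reject (unblocked? κ) {w} {ws} (λ ¬κw → ¬κw κw) =
      s≤s (ℕP.≤-reflexive (≡-sym (cong length (filter-all (unblocked? κ) rest-unblocked))))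
      where
      rest-unblocked : All (λ w' → ¬ Blocks κ w') ws
      rest-unblocked = All.tabulate λ w'∈ κw' → All.lookup w∉ w'∈ (≡-sym (one (there w'∈) (here refl) κw' κw))
    by-cases (no ¬κw) rewrite filter-accept (unblocked? κ) {w} {ws} ¬κw =
      s≤s (length-unblocked κ ws uws λ p q → one (there p) (there q))

  survivor : ∀ (K : List B) (ws : List A) → Unique ws → (∀ {κ} → κ ∈ K → AtMostOne κ ws) →
             length K < length ws → Σ A λ w → w ∈ ws × (∀ {κ} → κ ∈ K → ¬ Blocks κ w)
  survivor []      (w ∷ _) _   _   _ = w , here refl , λ ()
  survivor (κ ∷ K) ws      uws one K<ws
    with survivor K (filter (unblocked? κ) ws) (UniqueP.filter⁺ (unblocked? κ) uws)
           (λ κ'∈ p q → one (there κ'∈) (proj₁ (∈-filter⁻ (unblocked? κ) p)) (proj₁ (∈-filter⁻ (unblocked? κ) q)))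
           (ℕ.s≤s⁻¹ (ℕP.≤-trans K<ws (length-unblocked κ ws uws (one (here refl)))))
  ... | w , w∈ , free =
    w , proj₁ (∈-filter⁻ (unblocked? κ) {xs = ws} w∈) ,
    λ { (here refl) → proj₂ (∈-filter⁻ (unblocked? κ) {xs = ws} w∈) ; (there κ'∈) → free κ'∈ }

crossing-edge : ∀ {A : Set} {R : A → A → Set} {Q : A → Set} → Decidable Q →
                ∀ {z a} → ¬ Q z → Q a → Star R z a →
                Σ A λ x → Σ A λ y → ¬ Q x × Q y × R x y
crossing-edge Q? ¬Qz Qa ε = ⊥-elim (¬Qz Qa)
crossing-edge Q? {z} ¬Qz Qa (_◅_ {j = z'} zz' rest) with Q? z'
... | yes Qz' = z , z' , ¬Qz , Qz' , zz'
... | no ¬Qz' = crossing-edge Q? ¬Qz' Qa rest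

module GraphFacts {m : ℕ} (H : Graph m) where

  adj-sym : ∀ {a b} → Adj H a b → Adj H b a
  adj-sym {a} {b} ab = trans (Graph.sym H b a) ab

  adj⇒≢ : ∀ {a b} → Adj H a b → a ≢ b
  adj⇒≢ {a} ab refl with trans (≡-sym ab) (irrefl H a)
  ... | ()

  Chain : Fin m → List (Fin m) → Set
  Chain c []       = ⊤
  Chain c (y ∷ ys) = Adj H c y × Chain y ys

  chain-step : ∀ c ys → Chain c ys → (i : Fin (length ys)) →
               Adj H (lookup (c ∷ ys) (inject₁ i)) (lookup (c ∷ ys) (suc i))
  chain-step c (y ∷ ys) (cy , _)  zero    = cy
  chain-step c (y ∷ ys) (_ , chy) (suc i) = chain-step y ys chy i

  close-cycle : ∀ c ys → Unique (c ∷ ys) → Chain c ys → Adj H (lastOf c ys) c →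
                2 ≤ length ys → Cycle H (length ys)
  close-cycle c ys uniq chain closing long = record
    { len≥3 = long
    ; vert  = lookup (c ∷ ys)
    ; inj   = lookup-injective (c ∷ ys) uniq
    ; step  = chain-step c ys chain
    ; close = subst (λ z → Adj H z c) (≡-sym (lookup-last c ys)) closing }

  no-triangle : GirthAtLeast H 5 → ∀ {a b c} → Adj H a b → Adj H b c → Adj H c a → ⊥
  no-triangle girth ab bc ca
    with girth 2 (close-cycle _ (_ ∷ _ ∷ [])
                   ((adj⇒≢ ab ∷ ≢-sym (adj⇒≢ ca) ∷ []) ∷ (adj⇒≢ bc ∷ []) ∷ [] ∷ [])
                   (ab , bc , tt) ca (s≤s (s≤s z≤n)))
  ... | s≤s (s≤s (s≤s ()))

  no-square : GirthAtLeast H 5 → ∀ {a b c e} → Adj H a b → Adj H b c → Adj H c e → Adj H e a →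
              a ≢ c → b ≢ e → ⊥
  no-square girth ab bc ce ea a≢c b≢e
    with girth 3 (close-cycle _ (_ ∷ _ ∷ _ ∷ [])
                   ((adj⇒≢ ab ∷ a≢c ∷ ≢-sym (adj⇒≢ ea) ∷ []) ∷ (adj⇒≢ bc ∷ b≢e ∷ []) ∷ (adj⇒≢ ce ∷ []) ∷ [] ∷ [])
                   (ab , bc , ce , tt) ea (s≤s (s≤s z≤n)))
  ... | s≤s (s≤s (s≤s (s≤s ())))

  Near : Fin m → Fin m → Set
  Near κ w = w ≡ κ ⊎ Adj H w κ

  near? : ∀ κ w → Dec (Near κ w)
  near? κ w = (w ≟ κ) ⊎-dec (adj H w κ Bool.≟ true)

  -- With girth ≥ 5, a vertex c ≠ κ has at most one neighbour near κ:
  -- two would close a triangle or a 4-cycle through c and κ.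
  near-unique : GirthAtLeast H 5 → ∀ {c κ w₁ w₂} → κ ≢ c → Adj H c w₁ → Adj H c w₂ →
                Near κ w₁ → Near κ w₂ → w₁ ≡ w₂
  near-unique girth {c} {κ} {w₁} {w₂} κ≢c cw₁ cw₂ near₁ near₂ with w₁ ≟ w₂
  ... | yes w₁≡w₂ = w₁≡w₂
  ... | no w₁≢w₂  = ⊥-elim (cases near₁ near₂)
    where
    cases : Near κ w₁ → Near κ w₂ → ⊥
    cases (inj₁ w₁≡κ) (inj₁ w₂≡κ) = w₁≢w₂ (trans w₁≡κ (≡-sym w₂≡κ))
    cases (inj₁ w₁≡κ) (inj₂ w₂κ)  = no-triangle girth (subst (Adj H c) w₁≡κ cw₁) (adj-sym w₂κ) (adj-sym cw₂)
    cases (inj₂ w₁κ)  (inj₁ w₂≡κ) = no-triangle girth (subst (Adj H c) w₂≡κ cw₂) (adj-sym w₁κ) (adj-sym cw₁)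
    cases (inj₂ w₁κ)  (inj₂ w₂κ)  = no-square girth cw₁ w₁κ (adj-sym w₂κ) (adj-sym cw₂) (≢-sym κ≢c) w₁≢w₂

  data Walk (Q : Fin m → Set) : Fin m → Fin m → Set where
    [_]  : ∀ {a} → Q a → Walk Q a a
    step : ∀ {a b c} → Q a → Adj H a b → Walk Q b c → Walk Q a c

  module _ {Q : Fin m → Set} where

    vertices : ∀ {a b} → Walk Q a b → List (Fin m)
    vertices ([_] {a} _)      = a ∷ []
    vertices (step {a} _ _ W) = a ∷ vertices W

    start : ∀ {a b} → Walk Q a b → Q a
    start [ qa ]        = qa
    start (step qa _ _) = qa

    _++_ : ∀ {a b c} → Walk Q a b → Walk Q b c → Walk Q a c
    [ _ ]         ++ W' = W'
    step qa ab W  ++ W' = step qa ab (W ++ W')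

    reverse-onto : ∀ {a b c} → Walk Q a b → Walk Q a c → Walk Q b c
    reverse-onto [ _ ]          acc = acc
    reverse-onto (step _ ab W) acc = reverse-onto W (step (start W) (adj-sym ab) acc)

    reverse : ∀ {a b} → Walk Q a b → Walk Q b a
    reverse W = reverse-onto W [ start W ]

    weaken : ∀ {Q' : Fin m → Set} {a b} → (∀ {z} → Q z → Q' z) → Walk Q a b → Walk Q' a b
    weaken Q⇒Q' [ qa ]         = [ Q⇒Q' qa ]
    weaken Q⇒Q' (step qa ab W) = step (Q⇒Q' qa) ab (weaken Q⇒Q' W)

    toStar : ∀ {a b} → Walk Q a b → Star (Adj H) a b
    toStar [ _ ]         = ε
    toStar (step _ ab W) = ab ◅ toStar W

    all-Q : ∀ {a b} (W : Walk Q a b) → All Q (vertices W)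
    all-Q [ qa ]        = qa ∷ []
    all-Q (step qa _ W) = qa ∷ all-Q W

    chain : ∀ {x a b} → Adj H x a → (W : Walk Q a b) → Chain x (vertices W)
    chain xa [ _ ]          = xa , tt
    chain xa (step _ ab W)  = xa , chain ab W

    last-vertex : ∀ {a b} c (W : Walk Q a b) → lastOf c (vertices W) ≡ b
    last-vertex c [ _ ]         = refl
    last-vertex c (step _ _ W)  = last-vertex _ W

    two-vertices : ∀ {a b} → a ≢ b → (W : Walk Q a b) → 2 ≤ length (vertices W)
    two-vertices a≢b [ _ ]                  = ⊥-elim (a≢b refl)
    two-vertices a≢b (step _ _ [ _ ])        = s≤s (s≤s z≤n)
    two-vertices a≢b (step _ _ (step _ _ _)) = s≤s (s≤s z≤n)

    Path : Fin m → Fin m → Set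
    Path a b = Σ (Walk Q a b) λ W → Unique (vertices W)

    suffix : ∀ {a b c} (W : Walk Q c b) → a ∈ vertices W → Unique (vertices W) → Path a b
    suffix W@([ _ ])       (here refl) uW       = W , uW
    suffix W@(step _ _ _)  (here refl) uW       = W , uW
    suffix (step _ _ W)    (there a∈)  (_ ∷ uW) = suffix W a∈ uW

    erase-loops : ∀ {a b} → Walk Q a b → Path a b
    erase-loops [ qa ] = [ qa ] , [] ∷ []
    erase-loops (step {a} qa ab W) with erase-loops W
    ... | W' , uW' with DecMembership._∈?_ _≟_ a (vertices W')
    ... | yes a∈ = suffix W' a∈ uW'
    ... | no a∉  = step qa ab W' , ¬Any⇒All¬ _ a∉ ∷ uW'

  -- In a forest, two neighbours of x joined by a walk avoiding x coincide:
  -- otherwise the walk, made a path, would close a cycle through x.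
  forest-unique-neighbour : Forest H → ∀ {x a b} → Adj H x a → Adj H x b →
                            Walk (_≢ x) a b → a ≡ b
  forest-unique-neighbour forest {x} {a} {b} xa xb W with a ≟ b
  ... | yes a≡b = a≡b
  ... | no a≢b with erase-loops W
  ... | P , uP =
    ⊥-elim (forest _ (close-cycle x (vertices P)
                        (All.map (λ z≢x x≡z → z≢x (≡-sym x≡z)) (all-Q P) ∷ uP)
                        (chain xa P)
                        (subst (λ z → Adj H z x) (≡-sym (last-vertex x P)) (adj-sym xb))
                        (two-vertices a≢b P)))

module Construction {n d t : ℕ} (G : Graph n) (girth : GirthAtLeast G 5) (minDeg : MinDegree G d)
                    (T : Graph d) (forest : Forest T) (u : Fin t → Fin d) (reps : ComponentReps T u)
                    (v : Fin t → Fin n) (indep : IndependentSet G v) where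

  open DecMembership (_≟_ {d}) using (_∈?_)
  module TF = GraphFacts T
  module GF = GraphFacts G
  open TF using (Walk; [_]; step; _++_; reverse; weaken; toStar)

  same-root : ∀ {x i j} → Star (Adj T) x (u i) → Star (Adj T) x (u j) → i ≡ j
  same-root {x} {i} {j} x~ui x~uj with reps x
  ... | _ , _ , only = trans (only i x~ui) (≡-sym (only j x~uj))

  record PartialEmbedding (missing : ℕ) : Set where
    field
      P         : List (Fin d)
      f         : Fin d → Fin n
      unique    : Unique P
      size      : d ≤ length P + missing
      roots∈    : ∀ i → u i ∈ P
      f-root    : ∀ i → f (u i) ≡ v i
      f-inj     : ∀ {x y} → x ∈ P → y ∈ P → f x ≡ f y → x ≡ y
      f-adj     : ∀ {x y} → x ∈ P → y ∈ P → Adj T x y → Adj G (f x) (f y)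
      f-reflect : ∀ {x y} → x ∈ P → y ∈ P → Adj G (f x) (f y) → Adj T x y
      rooted    : ∀ {x} → x ∈ P → Σ (Fin t) λ i → Walk (_∈ P) x (u i)

  module PE = PartialEmbedding

  module Extension {r} (E : PartialEmbedding (suc r)) {x y : Fin d}
                   (x∉ : x ∉ PE.P E) (y∈ : y ∈ PE.P E) (xy : Adj T x y) where
    open PartialEmbedding E

    avoids-x : ∀ {q} → q ∈ P → q ≢ x
    avoids-x q∈ q≡x = x∉ (subst (_∈ P) q≡x q∈)

    only-neighbour : ∀ {y'} → y' ∈ P → Adj T x y' → y' ≡ y
    only-neighbour y'∈ xy' with rooted y'∈ | rooted y∈
    ... | i , W' | j , W with same-root (xy' ◅ toStar W') (xy ◅ toStar W)
    ... | refl = TF.forest-unique-neighbour forest xy' xy (weaken avoids-x (W' ++ reverse W))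

    Blocks : Fin d → Fin n → Set
    Blocks q w = q ≢ y × GF.Near (f q) w

    blocks? : ∀ q w → Dec (Blocks q w)
    blocks? q w = ¬? (q ≟ y) ×-dec GF.near? (f q) w

    open Survivor Blocks blocks?

    neighbours : List (Fin n)
    neighbours = filterᵇ (adj G (f y)) (allFin n)

    neighbour : ∀ {w} → w ∈ neighbours → Adj G (f y) w
    neighbour {w} w∈ =
      Equivalence.to T-≡ (proj₂ (∈-filter⁻ (λ z → T? (adj G (f y) z)) {xs = allFin n} w∈))

    blocks-one : ∀ {q} → q ∈ P → AtMostOne q neighbours
    blocks-one q∈ w₁∈ w₂∈ (q≢y , near₁) (_ , near₂) =
      GF.near-unique girth (λ fq≡fy → q≢y (f-inj q∈ y∈ fq≡fy)) (neighbour w₁∈) (neighbour w₂∈) near₁ near₂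

    -- A neighbour of f y far from every other f q, q ∈ P, exists because
    -- |P| < d ≤ deg (f y).
    fresh : Σ (Fin n) λ w → Adj G (f y) w × (∀ {q} → q ∈ P → q ≢ y → ¬ GF.Near (f q) w)
    fresh with survivor P neighbours
                 (UniqueP.filter⁺ (λ z → T? (adj G (f y) z)) (UniqueP.allFin⁺ n)) blocks-one
                 (ℕP.<-≤-trans (missing⇒length< (unique) x∉) (proj₁ minDeg (f y)))
    ... | w , w∈ , free = w , neighbour w∈ , λ q∈ q≢y near → free q∈ (q≢y , near)

    module _ (w : Fin n) (yw : Adj G (f y) w) (far : ∀ {q} → q ∈ P → q ≢ y → ¬ GF.Near (f q) w) where

      f′ : Fin d → Fin n
      f′ = updateAt f x (λ _ → w)

      f′-x : f′ x ≡ w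
      f′-x = updateAt-updates x f

      f′-P : ∀ {q} → q ∈ P → f′ q ≡ f q
      f′-P q∈ = updateAt-minimal _ x f (avoids-x q∈)

      w-new : ∀ {q} → q ∈ P → w ≢ f q
      w-new {q} q∈ w≡fq with q ≟ y
      ... | yes refl = GF.adj⇒≢ yw (≡-sym w≡fq)
      ... | no q≢y   = far q∈ q≢y (inj₁ w≡fq)

      x-adj : ∀ {q} → q ∈ P → Adj T x q → Adj G w (f q)
      x-adj q∈ xq with only-neighbour q∈ xq
      ... | refl = GF.adj-sym yw

      x-reflect : ∀ {q} → q ∈ P → Adj G w (f q) → Adj T x q
      x-reflect {q} q∈ wfq with q ≟ y
      ... | yes refl = xy
      ... | no q≢y   = ⊥-elim (far q∈ q≢y (inj₂ wfq))

      f′-inj : ∀ {a b} → a ∈ x ∷ P → b ∈ x ∷ P → f′ a ≡ f′ b → a ≡ b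
      f′-inj (here refl) (here refl) _  = refl
      f′-inj (here refl) (there b∈)  eq = ⊥-elim (w-new b∈ (trans (≡-sym f′-x) (trans eq (f′-P b∈))))
      f′-inj (there a∈)  (here refl) eq = ⊥-elim (w-new a∈ (trans (≡-sym f′-x) (trans (≡-sym eq) (f′-P a∈))))
      f′-inj (there a∈)  (there b∈)  eq = f-inj a∈ b∈ (trans (≡-sym (f′-P a∈)) (trans eq (f′-P b∈)))

      f′-adj : ∀ {a b} → a ∈ x ∷ P → b ∈ x ∷ P → Adj T a b → Adj G (f′ a) (f′ b)
      f′-adj (here refl) (here refl) xx = ⊥-elim (TF.adj⇒≢ xx refl)
      f′-adj (here refl) (there b∈)  xb = subst₂ (Adj G) (≡-sym f′-x) (≡-sym (f′-P b∈)) (x-adj b∈ xb)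
      f′-adj (there a∈)  (here refl) ax =
        subst₂ (Adj G) (≡-sym (f′-P a∈)) (≡-sym f′-x) (GF.adj-sym (x-adj a∈ (TF.adj-sym ax)))
      f′-adj (there a∈)  (there b∈)  ab = subst₂ (Adj G) (≡-sym (f′-P a∈)) (≡-sym (f′-P b∈)) (f-adj a∈ b∈ ab)

      f′-reflect : ∀ {a b} → a ∈ x ∷ P → b ∈ x ∷ P → Adj G (f′ a) (f′ b) → Adj T a b
      f′-reflect (here refl) (here refl) ww = ⊥-elim (GF.adj⇒≢ ww refl)
      f′-reflect (here refl) (there b∈)  wb = x-reflect b∈ (subst₂ (Adj G) f′-x (f′-P b∈) wb)
      f′-reflect (there a∈)  (here refl) aw =
        TF.adj-sym (x-reflect a∈ (GF.adj-sym (subst₂ (Adj G) (f′-P a∈) f′-x aw)))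
      f′-reflect (there a∈)  (there b∈)  ab = f-reflect a∈ b∈ (subst₂ (Adj G) (f′-P a∈) (f′-P b∈) ab)

      rooted′ : ∀ {a} → a ∈ x ∷ P → Σ (Fin t) λ i → Walk (_∈ x ∷ P) a (u i)
      rooted′ (here refl) with rooted y∈
      ... | i , W = i , step (here refl) xy (weaken there W)
      rooted′ (there a∈) with rooted a∈
      ... | i , W = i , weaken there W

      extend-by : PartialEmbedding r
      extend-by = record
        { P         = x ∷ P
        ; f         = f′
        ; unique    = ¬Any⇒All¬ P x∉ ∷ unique
        ; size      = subst (d ≤_) (ℕP.+-suc (length P) r) (size)
        ; roots∈    = λ i → there (roots∈ i)
        ; f-root    = λ i → trans (f′-P (roots∈ i)) (f-root i)
        ; f-inj     = f′-inj
        ; f-adj     = f′-adj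
        ; f-reflect = f′-reflect
        ; rooted    = rooted′ }

    extension : PartialEmbedding r
    extension = let (w , yw , far) = fresh in extend-by w yw far

  grow-towards : ∀ {r} (E : PartialEmbedding (suc r)) {z} → z ∉ PE.P E → PartialEmbedding r
  grow-towards E {z} z∉ =
    let (i , z~ui , _) = reps z
        (x , y , x∉ , y∈ , xy) = crossing-edge (_∈? PE.P E) z∉ (PE.roots∈ E i) z~ui
    in Extension.extension E x∉ y∈ xy

  initial : PartialEmbedding d
  initial = record
    { P         = P₀
    ; f         = f₀
    ; unique    = UniqueP.map⁺ root-inj (UniqueP.allFin⁺ t)
    ; size      = ℕP.m≤n+m d (length P₀)
    ; roots∈    = λ i → ∈-map⁺ u (∈-allFin i)
    ; f-root    = f₀-root
    ; f-inj     = f₀-inj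
    ; f-adj     = f₀-adj
    ; f-reflect = f₀-reflect
    ; rooted    = f₀-rooted }
    where
    P₀ : List (Fin d)
    P₀ = map u (allFin t)

    f₀ : Fin d → Fin n
    f₀ z = v (proj₁ (reps z))

    f₀-root : ∀ i → f₀ (u i) ≡ v i
    f₀-root i = cong v (≡-sym (proj₂ (proj₂ (reps (u i))) i ε))

    root-inj : ∀ {i j} → u i ≡ u j → i ≡ j
    root-inj {i} ui≡uj = same-root ε (subst (Star (Adj T) (u i)) ui≡uj ε)

    f₀-inj : ∀ {a b} → a ∈ P₀ → b ∈ P₀ → f₀ a ≡ f₀ b → a ≡ b
    f₀-inj a∈ b∈ eq with ∈-map⁻ u a∈ | ∈-map⁻ u b∈
    ... | i , _ , refl | j , _ , refl =
      cong u (proj₁ indep (trans (≡-sym (f₀-root i)) (trans eq (f₀-root j))))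

    f₀-rooted : ∀ {a} → a ∈ P₀ → Σ (Fin t) λ i → Walk (_∈ P₀) a (u i)
    f₀-rooted a∈ with ∈-map⁻ u a∈
    ... | i , _ , refl = i , [ a∈ ]

    -- distinct roots lie in distinct components, so are never adjacent
    f₀-adj : ∀ {a b} → a ∈ P₀ → b ∈ P₀ → Adj T a b → Adj G (f₀ a) (f₀ b)
    f₀-adj a∈ b∈ ab with ∈-map⁻ u a∈ | ∈-map⁻ u b∈
    ... | i , _ , refl | j , _ , refl = ⊥-elim (TF.adj⇒≢ ab (cong u (same-root ε (ab ◅ ε))))

    f₀-reflect : ∀ {a b} → a ∈ P₀ → b ∈ P₀ → Adj G (f₀ a) (f₀ b) → Adj T a b
    f₀-reflect a∈ b∈ fafb with ∈-map⁻ u a∈ | ∈-map⁻ u b∈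
    ... | i , _ , refl | j , _ , refl = ⊥-elim (proj₂ indep i j (subst₂ (Adj G) (f₀-root i) (f₀-root j) fafb))

  Spanning : ∀ {r} → PartialEmbedding r → Set
  Spanning E = ∀ z → z ∈ PE.P E

  -- Extend until P is everything; the budget `missing` bounds the number of steps.
  grow : ∀ r → PartialEmbedding r → Σ ℕ λ r′ → Σ (PartialEmbedding r′) Spanning
  grow r E with FinP.all? (_∈? PE.P E)
  ... | yes spans = r , E , spans
  ... | no ¬spans with FinP.¬∀⟶∃¬ d (_∈ PE.P E) (_∈? PE.P E) ¬spans
  grow zero    E | no _ | z , z∉ =
    ⊥-elim (ℕP.<⇒≱ (missing⇒length< (PE.unique E) z∉) (subst (d ≤_) (ℕP.+-identityʳ _) (PE.size E)))
  grow (suc r) E | no _ | z , z∉ = grow r (grow-towards E z∉)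

  InducedCopy : Set
  InducedCopy = Σ (Fin d → Fin n) λ f →
                  Injective _≡_ _≡_ f × (∀ i → f (u i) ≡ v i) × (∀ x y → Adj T x y ⇔ Adj G (f x) (f y))

  spanning⇒copy : ∀ {r} (E : PartialEmbedding r) → Spanning E → InducedCopy
  spanning⇒copy E spans =
    f , (λ eq → f-inj (spans _) (spans _) eq) , f-root ,
    λ x y → mk⇔ (f-adj (spans x) (spans y)) (f-reflect (spans x) (spans y))
    where open PartialEmbedding E

lemma17 : ∀ {n d t : ℕ} (G : Graph n) → GirthAtLeast G 5 → MinDegree G d →
    (T : Graph d) → Forest T →
    (u : Fin t → Fin d) → ComponentReps T u →
    (v : Fin t → Fin n) → IndependentSet G v →
    Σ (Fin d → Fin n) λ f →
    Injective _≡_ _≡_ f ×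
    (∀ i → f (u i) ≡ v i) ×
    (∀ x y → Adj T x y ⇔ Adj G (f x) (f y))
lemma17 {d = d} G girth minDeg T forest u reps v indep =
  let (_ , E , spans) = grow d initial in spanning⇒copy E spans
  where open Construction G girth minDeg T forest u reps v indep
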